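{- Let $L$ be a matroid on $A\cup B$. Then $(A,B)$ is a free separator of $L$ (i.e. $L=L|A\mathbin{\Join} L.B$) if and only if every cyclic flat $Z$ of $L$ satisfies either $Z\subseteq A$ or $A-B\subseteq Z$.
   Context: $L|A$ is restriction to $A$; $L.B$ is the contraction of $L$ to $B$, i.e. $L/((A\cup B)-B)$. The matroids $L|A$ and $L.B$ are matched ($L|A.(A\cap B)=L.B|(A\cap B)$). For matched $M(A)$, $N(B)$, the free splice $M\mathbin{\Join} N$ is the matroid on $A\cup B$ with rank $r(X)=\min\{r_M(X\cap A)+|X-A|,\ r_N(X\cap B)+r_M(A-B)\}$. A cyclic flat is a flat that is a union of circuits. -}

module Defs where

open import Data.Nat using (ℕ; _+_; _∸_; _≤_; _<_; _⊓_)
open import Data.Fin using (Fin)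
open import Data.Fin.Subset using (Subset; _∈_; _∉_; _⊆_; _⊂_; _∪_; _∩_; ∁; ∣_∣; ⁅_⁆)
open import Data.Product using (Σ; _×_)
open import Relation.Binary.PropositionalEquality using (_≡_)

_∖_ : ∀ {n} → Subset n → Subset n → Subset n
X ∖ Y = X ∩ ∁ Y

record Matroid (n : ℕ) : Set where
  field
    r         : Subset n → ℕ
    r-bound   : ∀ X → r X ≤ ∣ X ∣
    r-mono    : ∀ {X Y} → X ⊆ Y → r X ≤ r Y
    r-submod  : ∀ X Y → r (X ∪ Y) + r (X ∩ Y) ≤ r X + r Y
open Matroid public

-- Rank of the restriction L|A (a matroid on A); only meaningful on subsets of A.
restrictRank : ∀ {n} → Matroid n → Subset n → Subset n → ℕ
restrictRank L A X = r L X

-- Rank of the contraction L.B = L / ((A∪B) - B), ground set E = A ∪ B,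
-- so the contracted set is (A ∪ B) ∖ B; only meaningful on subsets of B.
contractToRank : ∀ {n} → Matroid n → Subset n → Subset n → Subset n → ℕ
contractToRank L A B Y = r L (Y ∪ ((A ∪ B) ∖ B)) ∸ r L ((A ∪ B) ∖ B)

-- Rank function of the free splice M ⋈ N of matched M(A), N(B), given
-- by their rank functions rM (on subsets of A) and rN (on subsets of B):
-- r(X) = min { rM(X∩A) + |X−A| , rN(X∩B) + rM(A−B) }.
spliceRank : ∀ {n} → (Subset n → ℕ) → (Subset n → ℕ) →
             Subset n → Subset n → Subset n → ℕ
spliceRank rM rN A B X = (rM (X ∩ A) + ∣ X ∖ A ∣) ⊓ (rN (X ∩ B) + rM (A ∖ B))

FreeSeparator : ∀ {n} → Matroid n → Subset n → Subset n → Set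
FreeSeparator L A B =
  ∀ X → r L X ≡ spliceRank (restrictRank L A) (contractToRank L A B) A B X

Dependent : ∀ {n} → Matroid n → Subset n → Set
Dependent L X = r L X < ∣ X ∣

Circuit : ∀ {n} → Matroid n → Subset n → Set
Circuit L C = Dependent L C × (∀ D → D ⊂ C → r L D ≡ ∣ D ∣)

Flat : ∀ {n} → Matroid n → Subset n → Set
Flat L Z = ∀ e → e ∉ Z → r L Z < r L (Z ∪ ⁅ e ⁆)

-- cyclic: union of circuits (every element lies in a circuit contained in Z)
Cyclic : ∀ {n} → Matroid n → Subset n → Set
Cyclic L Z = ∀ e → e ∈ Z → Σ (Subset _) λ C → Circuit L C × C ⊆ Z × e ∈ C

CyclicFlat : ∀ {n} → Matroid n → Subset n → Set
CyclicFlat L Z = Flat L Z × Cyclic L Z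

-- A cyclic flat Z meeting B − A while missing a point d of A − B defeats both branches of the
-- splice rank: since Z has no coloops, deleting a point of Z − A lowers the first branch but not
-- r(Z); since Z is a flat, r(Z ∪ d) > r(Z) while Z ∪ d lies in the set whose rank is the second
-- branch. Conversely every X has a cyclic flat Z with r(Z) + |X − Z| ≤ r(X), and Z ⊆ A or
-- A − B ⊆ Z bounds the first or the second branch at X by this quantity; both branches are
-- always at least r(X).
module Submission where

open import Defs
open import Data.Nat using (ℕ; suc; _+_; _∸_; _≤_; _<_; _⊓_; z≤n; s≤s; _≤?_; _<?_)
open import Data.Nat.Properties
open import Data.Nat.Induction using (<-wellFounded)
open import Data.Fin using (Fin) renaming (_≟_ to _≟ᶠ_)
open import Data.Fin.Properties using (any?)
open import Data.Fin.Subset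
  using (Subset; _∈_; _∉_; _⊆_; _⊂_; _⊃_; _∪_; _∩_; ∁; ∣_∣; ⁅_⁆; Empty)
  renaming (⊥ to ∅)
open import Data.Fin.Subset.Properties
open import Data.Fin.Subset.Induction using (⊂-wellFounded; ⊃-wellFounded)
open import Data.Bool using (true; false)
open import Data.Vec using ([]; _∷_)
open import Data.Empty using (⊥-elim)
open import Data.Product using (Σ; _×_; _,_; proj₁; proj₂)
open import Data.Sum using (_⊎_; inj₁; inj₂)
open import Function.Bundles using (_⇔_; mk⇔)
open import Induction.WellFounded using (Acc; acc)
open import Relation.Nullary using (¬_; yes; no)
open import Relation.Nullary.Decidable using (_×-dec_; ¬?; decidable-stable)
open import Relation.Binary.PropositionalEquality

private
  variable
    n : ℕ
    p q s : Subset n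
    x y : Fin n

_⊖_ : Subset n → Fin n → Subset n
p ⊖ x = p ∖ ⁅ x ⁆

x∈p∖q⁺ : x ∈ p → x ∉ q → x ∈ p ∖ q
x∈p∖q⁺ x∈p x∉q = x∈p∩q⁺ (x∈p , x∉p⇒x∈∁p x∉q)

x∈p∖q⁻ : ∀ (p q : Subset n) → x ∈ p ∖ q → x ∈ p × x ∉ q
x∈p∖q⁻ p q x∈p∖q with x∈p∩q⁻ p (∁ q) x∈p∖q
... | x∈p , x∈∁q = x∈p , x∈∁p⇒x∉p x∈∁q

p∖q⊆p : ∀ (p q : Subset n) → p ∖ q ⊆ p
p∖q⊆p p q = p∩q⊆p p (∁ q)

x∈p⊖y⁺ : x ∈ p → x ≢ y → x ∈ p ⊖ y
x∈p⊖y⁺ x∈p x≢y = x∈p∖q⁺ x∈p (x≢y⇒x∉⁅y⁆ x≢y)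

x∈p⊖y⁻ : ∀ (p : Subset n) y → x ∈ p ⊖ y → x ∈ p × x ≢ y
x∈p⊖y⁻ p y x∈p⊖y with x∈p∖q⁻ p ⁅ y ⁆ x∈p⊖y
... | x∈p , x∉⁅y⁆ = x∈p , x∉⁅y⁆⇒x≢y x∉⁅y⁆

x∈p⇒p⊖x⊂p : x ∈ p → p ⊖ x ⊂ p
x∈p⇒p⊖x⊂p {x = x} {p = p} x∈p =
  p∖q⊆p p ⁅ x ⁆ , x , x∈p , λ x∈p⊖x → proj₂ (x∈p⊖y⁻ p x x∈p⊖x) refl

∩-monoˡ : p ⊆ q → p ∩ s ⊆ q ∩ s
∩-monoˡ {p = p} {s = s} p⊆q x∈p∩s with x∈p∩q⁻ p s x∈p∩s
... | x∈p , x∈s = x∈p∩q⁺ (p⊆q x∈p , x∈s)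

∖-monoˡ : p ⊆ q → p ∖ s ⊆ q ∖ s
∖-monoˡ = ∩-monoˡ

∖-swap : ∀ (p q s : Subset n) → (p ∖ q) ∖ s ⊆ (p ∖ s) ∖ q
∖-swap p q s x∈ with x∈p∖q⁻ (p ∖ q) s x∈
... | x∈p∖q , x∉s with x∈p∖q⁻ p q x∈p∖q
...   | x∈p , x∉q = x∈p∖q⁺ (x∈p∖q⁺ x∈p x∉s) x∉q

[p∪q]∖q≡p∖q : ∀ (p q : Subset n) → (p ∪ q) ∖ q ≡ p ∖ q
[p∪q]∖q≡p∖q p q = ⊆-antisym ⊆ˡ (∖-monoˡ (p⊆p∪q q))
  where
  ⊆ˡ : (p ∪ q) ∖ q ⊆ p ∖ q
  ⊆ˡ x∈ with x∈p∖q⁻ (p ∪ q) q x∈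
  ... | x∈p∪q , x∉q with x∈p∪q⁻ p q x∈p∪q
  ...   | inj₁ x∈p = x∈p∖q⁺ x∈p x∉q
  ...   | inj₂ x∈q = ⊥-elim (x∉q x∈q)

p⊆q∪[p∖q] : ∀ (p q : Subset n) → p ⊆ q ∪ (p ∖ q)
p⊆q∪[p∖q] p q {x} x∈p with x ∈? q
... | yes x∈q = x∈p∪q⁺ (inj₁ x∈q)
... | no  x∉q = x∈p∪q⁺ (inj₂ (x∈p∖q⁺ x∈p x∉q))

p⊆[p∩q]∪[p∖q] : ∀ (p q : Subset n) → p ⊆ (p ∩ q) ∪ (p ∖ q)
p⊆[p∩q]∪[p∖q] p q {x} x∈p with x ∈? q
... | yes x∈q = x∈p∪q⁺ (inj₁ (x∈p∩q⁺ (x∈p , x∈q)))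
... | no  x∉q = x∈p∪q⁺ (inj₂ (x∈p∖q⁺ x∈p x∉q))

Empty[p∖q]⇒p⊆q : Empty (p ∖ q) → p ⊆ q
Empty[p∖q]⇒p⊆q {q = q} empty {x} x∈p with x ∈? q
... | yes x∈q = x∈q
... | no  x∉q = ⊥-elim (empty (x , x∈p∖q⁺ x∈p x∉q))

∣p∩q∣+∣p∖q∣≡∣p∣ : ∀ (p q : Subset n) → ∣ p ∩ q ∣ + ∣ p ∖ q ∣ ≡ ∣ p ∣
∣p∩q∣+∣p∖q∣≡∣p∣ []          []          = refl
∣p∩q∣+∣p∖q∣≡∣p∣ (true  ∷ p) (true  ∷ q) = cong suc (∣p∩q∣+∣p∖q∣≡∣p∣ p q)
∣p∩q∣+∣p∖q∣≡∣p∣ (true  ∷ p) (false ∷ q) = trans (+-suc _ _) (cong suc (∣p∩q∣+∣p∖q∣≡∣p∣ p q))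
∣p∩q∣+∣p∖q∣≡∣p∣ (false ∷ p) (_     ∷ q) = ∣p∩q∣+∣p∖q∣≡∣p∣ p q

∣p∪q∣≤∣p∣+∣q∣ : ∀ (p q : Subset n) → ∣ p ∪ q ∣ ≤ ∣ p ∣ + ∣ q ∣
∣p∪q∣≤∣p∣+∣q∣ []          []          = z≤n
∣p∪q∣≤∣p∣+∣q∣ (true  ∷ p) (true  ∷ q) = s≤s (≤-trans (∣p∪q∣≤∣p∣+∣q∣ p q) (+-monoʳ-≤ ∣ p ∣ (n≤1+n _)))
∣p∪q∣≤∣p∣+∣q∣ (true  ∷ p) (false ∷ q) = s≤s (∣p∪q∣≤∣p∣+∣q∣ p q)
∣p∪q∣≤∣p∣+∣q∣ (false ∷ p) (true  ∷ q) = ≤-trans (s≤s (∣p∪q∣≤∣p∣+∣q∣ p q)) (≤-reflexive (sym (+-suc _ _)))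
∣p∪q∣≤∣p∣+∣q∣ (false ∷ p) (false ∷ q) = ∣p∪q∣≤∣p∣+∣q∣ p q

x∈p⇒∣p∣≡1+∣p⊖x∣ : x ∈ p → ∣ p ∣ ≡ suc ∣ p ⊖ x ∣
x∈p⇒∣p∣≡1+∣p⊖x∣ {x = x} {p = p} x∈p = begin
  ∣ p ∣                         ≡⟨ ∣p∩q∣+∣p∖q∣≡∣p∣ p ⁅ x ⁆ ⟨
  ∣ p ∩ ⁅ x ⁆ ∣ + ∣ p ⊖ x ∣     ≡⟨ cong (λ t → ∣ t ∣ + ∣ p ⊖ x ∣) p∩⁅x⁆≡⁅x⁆ ⟩
  ∣ ⁅ x ⁆ ∣ + ∣ p ⊖ x ∣         ≡⟨ cong (_+ ∣ p ⊖ x ∣) (∣⁅x⁆∣≡1 x) ⟩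
  suc ∣ p ⊖ x ∣                 ∎
  where
  open ≡-Reasoning
  p∩⁅x⁆≡⁅x⁆ : p ∩ ⁅ x ⁆ ≡ ⁅ x ⁆
  p∩⁅x⁆≡⁅x⁆ = ⊆-antisym (p∩q⊆q p ⁅ x ⁆)
    (λ y∈⁅x⁆ → x∈p∩q⁺ (subst (_∈ p) (sym (x∈⁅y⁆⇒x≡y x y∈⁅x⁆)) x∈p , y∈⁅x⁆))

∣p∣≤1+∣p⊖x∣ : ∀ (p : Subset n) x → ∣ p ∣ ≤ suc ∣ p ⊖ x ∣
∣p∣≤1+∣p⊖x∣ p x = begin
  ∣ p ∣                         ≤⟨ p⊆q⇒∣p∣≤∣q∣ (p⊆q∪[p∖q] p ⁅ x ⁆) ⟩
  ∣ ⁅ x ⁆ ∪ (p ⊖ x) ∣           ≤⟨ ∣p∪q∣≤∣p∣+∣q∣ ⁅ x ⁆ (p ⊖ x) ⟩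
  ∣ ⁅ x ⁆ ∣ + ∣ p ⊖ x ∣         ≡⟨ cong (_+ ∣ p ⊖ x ∣) (∣⁅x⁆∣≡1 x) ⟩
  suc ∣ p ⊖ x ∣                 ∎
  where open ≤-Reasoning

∣p∖p∣≡0 : ∀ (p : Subset n) → ∣ p ∖ p ∣ ≡ 0
∣p∖p∣≡0 {n} p = trans (cong ∣_∣ (Empty-unique empty)) (∣⊥∣≡0 n)
  where
  empty : Empty (p ∖ p)
  empty (x , x∈p∖p) = let x∈p , x∉p = x∈p∖q⁻ p p x∈p∖p in x∉p x∈p

module _ {n : ℕ} (L : Matroid n) where

  private
    rk = r L

  Independent : Subset n → Set
  Independent I = ∣ I ∣ ≤ rk I

  Coloop : Subset n → Fin n → Set
  Coloop X e = rk (X ⊖ e) < rk X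

  ⊆∪⇒r≤r+∣∣ : ∀ {Y} X W → Y ⊆ X ∪ W → rk Y ≤ rk X + ∣ W ∣
  ⊆∪⇒r≤r+∣∣ {Y} X W Y⊆X∪W = begin
    rk Y                          ≤⟨ r-mono L Y⊆X∪W ⟩
    rk (X ∪ W)                    ≤⟨ m≤m+n _ _ ⟩
    rk (X ∪ W) + rk (X ∩ W)       ≤⟨ r-submod L X W ⟩
    rk X + rk W                   ≤⟨ +-monoʳ-≤ (rk X) (r-bound L W) ⟩
    rk X + ∣ W ∣                  ∎
    where open ≤-Reasoning

  independent-⊆ : ∀ {D I} → D ⊆ I → Independent I → Independent D
  independent-⊆ {D} {I} D⊆I I-independent = +-cancelʳ-≤ ∣ I ∖ D ∣ ∣ D ∣ (rk D) (begin
    ∣ D ∣ + ∣ I ∖ D ∣             ≡⟨ cong (λ t → ∣ t ∣ + ∣ I ∖ D ∣) I∩D≡D ⟨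
    ∣ I ∩ D ∣ + ∣ I ∖ D ∣         ≡⟨ ∣p∩q∣+∣p∖q∣≡∣p∣ I D ⟩
    ∣ I ∣                         ≤⟨ I-independent ⟩
    rk I                          ≤⟨ ⊆∪⇒r≤r+∣∣ D (I ∖ D) (p⊆q∪[p∖q] I D) ⟩
    rk D + ∣ I ∖ D ∣              ∎)
    where
    open ≤-Reasoning
    I∩D≡D : I ∩ D ≡ D
    I∩D≡D = ⊆-antisym (p∩q⊆q I D) (λ x∈D → x∈p∩q⁺ (D⊆I x∈D , x∈D))

  independent-extend : ∀ {X e} → e ∈ X → Coloop X e → Independent (X ⊖ e) → Independent X
  independent-extend {X} e∈X coloop X⊖e-independent =
    subst (_≤ rk X) (sym (x∈p⇒∣p∣≡1+∣p⊖x∣ e∈X)) (≤-trans (s≤s X⊖e-independent) coloop)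

  coloop-⊆ : ∀ {W T g} → W ⊆ T → g ∈ W → Coloop T g → Coloop W g
  coloop-⊆ {W} {T} {g} W⊆T g∈W coloop = +-cancelˡ-< (rk T) (rk (W ⊖ g)) (rk W) (begin-strict
    rk T + rk (W ⊖ g)                       ≤⟨ +-mono-≤ (r-mono L T⊆T⊖g∪W) (r-mono L W⊖g⊆T⊖g∩W) ⟩
    rk ((T ⊖ g) ∪ W) + rk ((T ⊖ g) ∩ W)     ≤⟨ r-submod L (T ⊖ g) W ⟩
    rk (T ⊖ g) + rk W                       <⟨ +-monoˡ-< (rk W) coloop ⟩
    rk T + rk W                             ∎)
    where
    open ≤-Reasoning
    T⊆T⊖g∪W : T ⊆ (T ⊖ g) ∪ W
    T⊆T⊖g∪W {x} x∈T with x ≟ᶠ g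
    ... | yes refl = x∈p∪q⁺ (inj₂ g∈W)
    ... | no  x≢g  = x∈p∪q⁺ (inj₁ (x∈p⊖y⁺ x∈T x≢g))
    W⊖g⊆T⊖g∩W : W ⊖ g ⊆ (T ⊖ g) ∩ W
    W⊖g⊆T⊖g∩W x∈W⊖g = x∈p∩q⁺ (∖-monoˡ W⊆T x∈W⊖g , p∖q⊆p W ⁅ g ⁆ x∈W⊖g)

  coloops⇒independent : ∀ {T} → (∀ f → f ∈ T → Coloop T f) → Independent T
  coloops⇒independent {T} coloop = go T ⊆-refl (⊂-wellFounded T)
    where
    go : ∀ W → W ⊆ T → Acc _⊂_ W → Independent W
    go W W⊆T (acc smaller) with nonempty? W
    ... | no W-empty =
      subst Independent (sym (Empty-unique W-empty)) (subst (_≤ rk ∅) (sym (∣⊥∣≡0 n)) z≤n)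
    ... | yes (g , g∈W) = independent-extend g∈W (coloop-⊆ W⊆T g∈W (coloop g (W⊆T g∈W)))
      (go (W ⊖ g) (⊆-trans (p∖q⊆p W ⁅ g ⁆) W⊆T) (smaller (x∈p⇒p⊖x⊂p g∈W)))

  circuit⇒¬coloop : ∀ {C e} → Circuit L C → e ∈ C → ¬ Coloop C e
  circuit⇒¬coloop (dependent , minimal) e∈C coloop = <⇒≱ dependent
    (independent-extend e∈C coloop (≤-reflexive (sym (minimal _ (x∈p⇒p⊖x⊂p e∈C)))))

  cyclic⇒¬coloop : ∀ {Z e} → Cyclic L Z → e ∈ Z → ¬ Coloop Z e
  cyclic⇒¬coloop cyclic e∈Z coloop with cyclic _ e∈Z
  ... | C , circuit , C⊆Z , e∈C = circuit⇒¬coloop circuit e∈C (coloop-⊆ C⊆Z e∈C coloop)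

  ¬coloop-minimal⇒circuit : ∀ {S e} → e ∈ S → ¬ Coloop S e →
    (∀ f → f ∈ S → f ≢ e → Coloop (S ⊖ f) e) → Circuit L S
  ¬coloop-minimal⇒circuit {S} {e} e∈S ¬coloop coloop-after = dependent , minimal
    where
    open ≤-Reasoning
    T = S ⊖ e
    rS≤rT : rk S ≤ rk T
    rS≤rT = ≮⇒≥ ¬coloop
    T-independent : Independent T
    T-independent = coloops⇒independent λ f f∈T → let f∈S , f≢e = x∈p⊖y⁻ S e f∈T in begin-strict
      rk (T ⊖ f)              ≤⟨ r-mono L (∖-swap S ⁅ e ⁆ ⁅ f ⁆) ⟩
      rk ((S ⊖ f) ⊖ e)        <⟨ coloop-after f f∈S f≢e ⟩
      rk (S ⊖ f)              ≤⟨ r-mono L (p∖q⊆p S ⁅ f ⁆) ⟩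
      rk S                    ≤⟨ rS≤rT ⟩
      rk T                    ∎
    dependent : rk S < ∣ S ∣
    dependent = begin-strict
      rk S                    ≤⟨ rS≤rT ⟩
      rk T                    ≤⟨ r-bound L T ⟩
      ∣ T ∣                   <⟨ n<1+n _ ⟩
      suc ∣ T ∣               ≡⟨ x∈p⇒∣p∣≡1+∣p⊖x∣ e∈S ⟨
      ∣ S ∣                   ∎
    deletion-independent : ∀ x → x ∈ S → Independent (S ⊖ x)
    deletion-independent x x∈S with x ≟ᶠ e
    ... | yes refl = T-independent
    ... | no  x≢e  = independent-extend (x∈p⊖y⁺ e∈S (≢-sym x≢e)) (coloop-after x x∈S x≢e)
      (independent-⊆ (⊆-trans (∖-swap S ⁅ x ⁆ ⁅ e ⁆) (p∖q⊆p T ⁅ x ⁆)) T-independent)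
    minimal : ∀ D → D ⊂ S → rk D ≡ ∣ D ∣
    minimal D (D⊆S , x , x∈S , x∉D) =
      ≤-antisym (r-bound L D) (independent-⊆ D⊆S⊖x (deletion-independent x x∈S))
      where
      D⊆S⊖x : D ⊆ S ⊖ x
      D⊆S⊖x y∈D = x∈p⊖y⁺ (D⊆S y∈D) λ { refl → x∉D y∈D }

  ¬coloop⇒on-circuit : ∀ {S e} → e ∈ S → ¬ Coloop S e →
    Σ (Subset n) λ C → Circuit L C × C ⊆ S × e ∈ C
  ¬coloop⇒on-circuit {S} {e} = go S (⊂-wellFounded S)
    where
    go : ∀ S → Acc _⊂_ S → e ∈ S → ¬ Coloop S e → Σ (Subset n) λ C → Circuit L C × C ⊆ S × e ∈ C
    go S (acc smaller) e∈S ¬coloop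
      with any? (λ f → (f ∈? S) ×-dec (¬? (f ≟ᶠ e) ×-dec ¬? (rk ((S ⊖ f) ⊖ e) <? rk (S ⊖ f))))
    ... | no none = S , ¬coloop-minimal⇒circuit e∈S ¬coloop coloop-after , ⊆-refl , e∈S
      where
      coloop-after : ∀ f → f ∈ S → f ≢ e → Coloop (S ⊖ f) e
      coloop-after f f∈S f≢e =
        decidable-stable (_ <? _) λ ¬coloop′ → none (f , f∈S , f≢e , ¬coloop′)
    ... | yes (f , f∈S , f≢e , ¬coloop′)
      with go (S ⊖ f) (smaller (x∈p⇒p⊖x⊂p f∈S)) (x∈p⊖y⁺ e∈S (≢-sym f≢e)) ¬coloop′
    ...   | C , circuit , C⊆S⊖f , e∈C = C , circuit , ⊆-trans C⊆S⊖f (p∖q⊆p S ⁅ f ⁆) , e∈C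

  coloop-free⇒cyclic : ∀ {X} → (∀ e → e ∈ X → ¬ Coloop X e) → Cyclic L X
  coloop-free⇒cyclic ¬coloop e e∈X = ¬coloop⇒on-circuit e∈X (¬coloop e e∈X)

  -- Z attains the minimum in the rank formula r X = min over cyclic flats Z of r Z + |X − Z|.
  RankWitness : Subset n → Set
  RankWitness X = Σ (Subset n) λ Z → CyclicFlat L Z × rk Z + ∣ X ∖ Z ∣ ≤ rk X

  rankWitness-⊆ : ∀ {X Y} → X ⊆ Y → rk Y ≤ rk X → RankWitness Y → RankWitness X
  rankWitness-⊆ X⊆Y rY≤rX (Z , cyclicFlat , bound) = Z , cyclicFlat ,
    ≤-trans (+-monoʳ-≤ (rk Z) (p⊆q⇒∣p∣≤∣q∣ (∖-monoˡ {s = Z} X⊆Y))) (≤-trans bound rY≤rX)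

  rankWitness-coloop : ∀ {X e} → Coloop X e → RankWitness (X ⊖ e) → RankWitness X
  rankWitness-coloop {X} {e} coloop (Z , cyclicFlat , bound) = Z , cyclicFlat , (begin
    rk Z + ∣ X ∖ Z ∣                ≤⟨ +-monoʳ-≤ (rk Z) (∣p∣≤1+∣p⊖x∣ (X ∖ Z) e) ⟩
    rk Z + suc ∣ (X ∖ Z) ⊖ e ∣      ≤⟨ +-monoʳ-≤ (rk Z) (s≤s (p⊆q⇒∣p∣≤∣q∣ (∖-swap X Z ⁅ e ⁆))) ⟩
    rk Z + suc ∣ (X ⊖ e) ∖ Z ∣      ≡⟨ +-suc (rk Z) _ ⟩
    suc (rk Z + ∣ (X ⊖ e) ∖ Z ∣)    ≤⟨ s≤s bound ⟩
    suc (rk (X ⊖ e))                ≤⟨ coloop ⟩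
    rk X                            ∎)
    where open ≤-Reasoning

  -- Close X up and delete coloops until neither is possible: deletions lower the rank, and
  -- additions keep it while enlarging the set.
  rankWitness : ∀ X → RankWitness X
  rankWitness X = go (<-wellFounded (rk X)) X ≤-refl (⊃-wellFounded X)
    where
    go : ∀ {k} → Acc _<_ k → ∀ X → rk X ≤ k → Acc _⊃_ X → RankWitness X
    go k-acc X rX≤k (acc larger)
      with any? (λ e → ¬? (e ∈? X) ×-dec (rk (X ∪ ⁅ e ⁆) ≤? rk X))
    ... | yes (e , e∉X , r[X∪e]≤rX) = rankWitness-⊆ (p⊆p∪q ⁅ e ⁆) r[X∪e]≤rX
      (go k-acc (X ∪ ⁅ e ⁆) (≤-trans r[X∪e]≤rX rX≤k)
        (larger (p⊆p∪q ⁅ e ⁆ , e , x∈p∪q⁺ (inj₂ (x∈⁅x⁆ e)) , e∉X)))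
    ... | no unaddable with any? (λ e → (e ∈? X) ×-dec (rk (X ⊖ e) <? rk X))
    ...   | no coloop-free = X , (flat , cyclic) , self-bound
      where
      flat : Flat L X
      flat e e∉X = ≰⇒> λ r[X∪e]≤rX → unaddable (e , e∉X , r[X∪e]≤rX)
      cyclic : Cyclic L X
      cyclic = coloop-free⇒cyclic λ e e∈X coloop → coloop-free (e , e∈X , coloop)
      self-bound : rk X + ∣ X ∖ X ∣ ≤ rk X
      self-bound = ≤-reflexive (trans (cong (rk X +_) (∣p∖p∣≡0 X)) (+-identityʳ (rk X)))
    ...   | yes (e , e∈X , coloop) with k-acc
    ...     | acc lower = rankWitness-coloop coloop
      (go (lower (<-≤-trans coloop rX≤k)) (X ⊖ e) ≤-refl (⊃-wellFounded (X ⊖ e)))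

  module _ (A B : Subset n) where

    rankViaA rankViaB : Subset n → ℕ
    rankViaA X = rk (X ∩ A) + ∣ X ∖ A ∣
    rankViaB X = rk ((X ∩ B) ∪ (A ∖ B))

    spliceRank≡rankViaA⊓rankViaB : ∀ X →
      spliceRank (restrictRank L A) (contractToRank L A B) A B X ≡ rankViaA X ⊓ rankViaB X
    spliceRank≡rankViaA⊓rankViaB X = cong (rankViaA X ⊓_) (begin
      rk ((X ∩ B) ∪ D) ∸ rk D + rk (A ∖ B)
        ≡⟨ cong (λ Y → rk ((X ∩ B) ∪ Y) ∸ rk Y + rk (A ∖ B)) ([p∪q]∖q≡p∖q A B) ⟩
      rk ((X ∩ B) ∪ (A ∖ B)) ∸ rk (A ∖ B) + rk (A ∖ B)
        ≡⟨ m∸n+n≡m (r-mono L (q⊆p∪q (X ∩ B) (A ∖ B))) ⟩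
      rankViaB X ∎)
      where
      open ≡-Reasoning
      D = (A ∪ B) ∖ B

    r≤rankViaA : ∀ X → rk X ≤ rankViaA X
    r≤rankViaA X = ⊆∪⇒r≤r+∣∣ (X ∩ A) (X ∖ A) (p⊆[p∩q]∪[p∖q] X A)

    ⊆[∩B]∪[A∖B] : (∀ x → x ∈ A ∪ B) → ∀ X → X ⊆ (X ∩ B) ∪ (A ∖ B)
    ⊆[∩B]∪[A∖B] covers X {x} x∈X with x ∈? B | x∈p∪q⁻ A B (covers x)
    ... | yes x∈B | _        = x∈p∪q⁺ (inj₁ (x∈p∩q⁺ (x∈X , x∈B)))
    ... | no  x∉B | inj₁ x∈A = x∈p∪q⁺ (inj₂ (x∈p∖q⁺ x∈A x∉B))
    ... | no  x∉B | inj₂ x∈B = ⊥-elim (x∉B x∈B)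

    r≤rankViaB : (∀ x → x ∈ A ∪ B) → ∀ X → rk X ≤ rankViaB X
    r≤rankViaB covers X = r-mono L (⊆[∩B]∪[A∖B] covers X)

    r<rankViaA : ∀ {Z e} → Cyclic L Z → e ∈ Z → e ∉ A → rk Z < rankViaA Z
    r<rankViaA {Z} {e} cyclic e∈Z e∉A = begin-strict
      rk Z                                  ≤⟨ ≮⇒≥ (cyclic⇒¬coloop cyclic e∈Z) ⟩
      rk (Z ⊖ e)                            ≤⟨ r≤rankViaA (Z ⊖ e) ⟩
      rk ((Z ⊖ e) ∩ A) + ∣ (Z ⊖ e) ∖ A ∣    <⟨ +-mono-≤-< (r-mono L (∩-monoˡ (p∖q⊆p Z ⁅ e ⁆)))
                                                         (p⊂q⇒∣p∣<∣q∣ [Z⊖e]∖A⊂Z∖A) ⟩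
      rankViaA Z                            ∎
      where
      open ≤-Reasoning
      [Z⊖e]∖A⊂Z∖A : (Z ⊖ e) ∖ A ⊂ Z ∖ A
      [Z⊖e]∖A⊂Z∖A = ∖-monoˡ (p∖q⊆p Z ⁅ e ⁆) , e , x∈p∖q⁺ e∈Z e∉A ,
        λ e∈ → proj₂ (x∈p⊖y⁻ Z e (proj₁ (x∈p∖q⁻ (Z ⊖ e) A e∈))) refl

    r<rankViaB : (∀ x → x ∈ A ∪ B) → ∀ {Z d} → Flat L Z → d ∈ A ∖ B → d ∉ Z → rk Z < rankViaB Z
    r<rankViaB covers {Z} {d} flat d∈A∖B d∉Z = <-≤-trans (flat d d∉Z) (r-mono L Z∪d⊆)
      where
      Z∪d⊆ : Z ∪ ⁅ d ⁆ ⊆ (Z ∩ B) ∪ (A ∖ B)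
      Z∪d⊆ x∈ with x∈p∪q⁻ Z ⁅ d ⁆ x∈
      ... | inj₁ x∈Z   = ⊆[∩B]∪[A∖B] covers Z x∈Z
      ... | inj₂ x∈⁅d⁆ = x∈p∪q⁺ (inj₂ (subst (_∈ A ∖ B) (sym (x∈⁅y⁆⇒x≡y d x∈⁅d⁆)) d∈A∖B))

    rankViaA≤r+∣∖∣ : ∀ {Z} X → Z ⊆ A → rankViaA X ≤ rk Z + ∣ X ∖ Z ∣
    rankViaA≤r+∣∖∣ {Z} X Z⊆A = begin
      rk (X ∩ A) + ∣ X ∖ A ∣
        ≤⟨ +-monoˡ-≤ ∣ X ∖ A ∣ (⊆∪⇒r≤r+∣∣ Z ((X ∩ A) ∖ Z) (p⊆q∪[p∖q] (X ∩ A) Z)) ⟩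
      rk Z + ∣ (X ∩ A) ∖ Z ∣ + ∣ X ∖ A ∣
        ≡⟨ +-assoc (rk Z) _ _ ⟩
      rk Z + (∣ (X ∩ A) ∖ Z ∣ + ∣ X ∖ A ∣)
        ≤⟨ +-monoʳ-≤ (rk Z) (+-mono-≤ (p⊆q⇒∣p∣≤∣q∣ inside) (p⊆q⇒∣p∣≤∣q∣ outside)) ⟩
      rk Z + (∣ (X ∖ Z) ∩ A ∣ + ∣ (X ∖ Z) ∖ A ∣)
        ≡⟨ cong (rk Z +_) (∣p∩q∣+∣p∖q∣≡∣p∣ (X ∖ Z) A) ⟩
      rk Z + ∣ X ∖ Z ∣ ∎
      where
      open ≤-Reasoning
      inside : (X ∩ A) ∖ Z ⊆ (X ∖ Z) ∩ A
      inside x∈ with x∈p∖q⁻ (X ∩ A) Z x∈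
      ... | x∈X∩A , x∉Z with x∈p∩q⁻ X A x∈X∩A
      ...   | x∈X , x∈A = x∈p∩q⁺ (x∈p∖q⁺ x∈X x∉Z , x∈A)
      outside : X ∖ A ⊆ (X ∖ Z) ∖ A
      outside x∈ with x∈p∖q⁻ X A x∈
      ... | x∈X , x∉A = x∈p∖q⁺ (x∈p∖q⁺ x∈X (λ x∈Z → x∉A (Z⊆A x∈Z))) x∉A

    rankViaB≤r+∣∖∣ : ∀ {Z} X → A ∖ B ⊆ Z → rankViaB X ≤ rk Z + ∣ X ∖ Z ∣
    rankViaB≤r+∣∖∣ {Z} X A∖B⊆Z = ⊆∪⇒r≤r+∣∣ Z (X ∖ Z) ⊆Z∪[X∖Z]
      where
      ⊆Z∪[X∖Z] : (X ∩ B) ∪ (A ∖ B) ⊆ Z ∪ (X ∖ Z)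
      ⊆Z∪[X∖Z] {x} x∈ with x ∈? Z | x∈p∪q⁻ (X ∩ B) (A ∖ B) x∈
      ... | yes x∈Z | _            = x∈p∪q⁺ (inj₁ x∈Z)
      ... | no  x∉Z | inj₁ x∈X∩B   = x∈p∪q⁺ (inj₂ (x∈p∖q⁺ (p∩q⊆p X B x∈X∩B) x∉Z))
      ... | no  x∉Z | inj₂ x∈A∖B   = ⊥-elim (x∉Z (A∖B⊆Z x∈A∖B))

    freeSeparator⇒cyclicFlats-split : (∀ x → x ∈ A ∪ B) → FreeSeparator L A B →
      ∀ Z → CyclicFlat L Z → Z ⊆ A ⊎ A ∖ B ⊆ Z
    freeSeparator⇒cyclicFlats-split covers free Z (flat , cyclic)
      with nonempty? (Z ∖ A) | nonempty? ((A ∖ B) ∖ Z)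
    ... | no Z∖A-empty | _ = inj₁ (Empty[p∖q]⇒p⊆q Z∖A-empty)
    ... | yes _ | no [A∖B]∖Z-empty = inj₂ (Empty[p∖q]⇒p⊆q [A∖B]∖Z-empty)
    ... | yes (e , e∈Z∖A) | yes (d , d∈[A∖B]∖Z) = ⊥-elim (<-irrefl rZ≡splice (⊓-glb
      (r<rankViaA cyclic e∈Z e∉A) (r<rankViaB covers flat d∈A∖B d∉Z)))
      where
      rZ≡splice : rk Z ≡ rankViaA Z ⊓ rankViaB Z
      rZ≡splice = trans (free Z) (spliceRank≡rankViaA⊓rankViaB Z)
      e∈Z = proj₁ (x∈p∖q⁻ Z A e∈Z∖A)
      e∉A = proj₂ (x∈p∖q⁻ Z A e∈Z∖A)
      d∈A∖B = proj₁ (x∈p∖q⁻ (A ∖ B) Z d∈[A∖B]∖Z)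
      d∉Z = proj₂ (x∈p∖q⁻ (A ∖ B) Z d∈[A∖B]∖Z)

    cyclicFlats-split⇒freeSeparator : (∀ x → x ∈ A ∪ B) →
      (∀ Z → CyclicFlat L Z → Z ⊆ A ⊎ A ∖ B ⊆ Z) → FreeSeparator L A B
    cyclicFlats-split⇒freeSeparator covers split X =
      trans (≤-antisym (⊓-glb (r≤rankViaA X) (r≤rankViaB covers X)) splice≤r)
            (sym (spliceRank≡rankViaA⊓rankViaB X))
      where
      splice≤r : rankViaA X ⊓ rankViaB X ≤ rk X
      splice≤r with rankWitness X
      ... | Z , cyclicFlat , bound with split Z cyclicFlat
      ...   | inj₁ Z⊆A   = ≤-trans (m⊓n≤m _ _) (≤-trans (rankViaA≤r+∣∖∣ X Z⊆A) bound)
      ...   | inj₂ A∖B⊆Z = ≤-trans (m⊓n≤n _ _) (≤-trans (rankViaB≤r+∣∖∣ X A∖B⊆Z) bound)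

theorem4p2 : ∀ {n} (L : Matroid n) (A B : Subset n) →
    (∀ x → x ∈ A ∪ B) →
    FreeSeparator L A B ⇔ (∀ Z → CyclicFlat L Z → Z ⊆ A ⊎ (A ∖ B) ⊆ Z)
theorem4p2 L A B covers = mk⇔
  (freeSeparator⇒cyclicFlats-split L A B covers)
  (cyclicFlats-split⇒freeSeparator L A B covers)
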